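{- Let $P$ be a finite poset, $n$ a positive integer, $p$ a prime number, and $m=n(p-1)+1$. Then $e(m,P)-1$ is divisible by $p$. In particular, for every positive integer $m$, $e(m,P)-1$ is even; it is divisible by $6$ if $m$ is odd, by $30$ if $m\equiv1\pmod 4$, by $42$ if $m\equiv 1\pmod 6$, and by $210$ if $m\equiv1\pmod{12}$.
   Context: For a finite poset $P$ on $K$ and a finite set $M$ disjoint from $K$ with $|M|=m$, $e(m,P)$ is the number of partial orders on $M\cup K$ inducing $P$ on $K$ whose set of minimal elements is exactly $M$. -}

module Defs where

open import Data.Nat using (ℕ; zero; suc; _+_)
open import Data.Bool using (Bool; true; false)
open import Data.Bool.Properties using () renaming (_≟_ to _≟ᵇ_)
open import Data.Fin using (Fin; zero; suc; _↑ˡ_; _↑ʳ_)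
open import Data.Fin.Properties using (all?) renaming (_≟_ to _≟ᶠ_)
open import Data.List using (List; []; _∷_; length; filter; cartesianProductWith)
open import Data.Product using (_×_; _,_)
open import Relation.Nullary using (¬_; Dec)
open import Relation.Nullary.Decidable using (_×-dec_; _→-dec_; ¬?)
open import Relation.Binary.PropositionalEquality using (_≡_)

-- A (Boolean-valued, hence decidable) binary relation on Fin N:
-- x ≤ y  iff  R x y ≡ true.
BRel : ℕ → Set
BRel N = Fin N → Fin N → Bool

IsPartialOrder : ∀ {N} → BRel N → Set
IsPartialOrder {N} R =
  (∀ x → R x x ≡ true) ×
  (∀ x y → R x y ≡ true → R y x ≡ true → x ≡ y) ×
  (∀ x y z → R x y ≡ true → R y z ≡ true → R x z ≡ true)

Minimal : ∀ {N} → BRel N → Fin N → Set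
Minimal {N} R x = ∀ y → R y x ≡ true → y ≡ x

-- Orders counted by e(m,P):  ground set M ∪ K = Fin (m + k), where
-- M is the image of _↑ˡ k (first m points) and K the image of m ↑ʳ_
-- (last k points).
Counted : (m : ℕ) {k : ℕ} → BRel k → BRel (m + k) → Set
Counted m {k} P R =
  IsPartialOrder R ×
  (∀ i j → R (m ↑ʳ i) (m ↑ʳ j) ≡ P i j) ×
  (∀ i → Minimal R (i ↑ˡ k)) ×
  (∀ j → ¬ Minimal R (m ↑ʳ j))

isPartialOrder? : ∀ {N} (R : BRel N) → Dec (IsPartialOrder R)
isPartialOrder? R =
  all? (λ x → R x x ≟ᵇ true) ×-dec
  (all? λ x → all? λ y → (R x y ≟ᵇ true) →-dec ((R y x ≟ᵇ true) →-dec (x ≟ᶠ y))) ×-dec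
  (all? λ x → all? λ y → all? λ z →
     (R x y ≟ᵇ true) →-dec ((R y z ≟ᵇ true) →-dec (R x z ≟ᵇ true)))

minimal? : ∀ {N} (R : BRel N) x → Dec (Minimal R x)
minimal? R x = all? λ y → (R y x ≟ᵇ true) →-dec (y ≟ᶠ x)

counted? : (m : ℕ) {k : ℕ} (P : BRel k) (R : BRel (m + k)) → Dec (Counted m P R)
counted? m {k} P R =
  isPartialOrder? R ×-dec
  (all? λ i → all? λ j → R (m ↑ʳ i) (m ↑ʳ j) ≟ᵇ P i j) ×-dec
  (all? λ i → minimal? R (i ↑ˡ k)) ×-dec
  (all? λ j → ¬? (minimal? R (m ↑ʳ j)))

-- Enumeration of all functions Fin n → A, each exactly once (as tuples),
-- given an exhaustive duplicate-free list of A.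
cons : ∀ {A : Set} {n} → A → (Fin n → A) → Fin (suc n) → A
cons a f zero    = a
cons a f (suc i) = f i

allFuns : ∀ {A : Set} → List A → (n : ℕ) → List (Fin n → A)
allFuns as zero    = (λ ()) ∷ []
allFuns as (suc n) = cartesianProductWith cons as (allFuns as n)

allBRel : (N : ℕ) → List (BRel N)
allBRel N = allFuns (allFuns (true ∷ false ∷ []) N) N

e : (m : ℕ) {k : ℕ} → BRel k → ℕ
e m {k} P = length (filter (counted? m P) (allBRel (m + k)))

module Submission where

open import Defs
open import Data.Nat using (ℕ; suc; _*_; _+_; _∸_; _%_; _≤_)
open import Data.Nat.Primality using (Prime)
open import Data.Integer using (+_; _-_)
open import Data.Integer.Divisibility using (_∣_)
open import Data.Product using (_×_)
open import Relation.Binary.PropositionalEquality using (_≡_)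

open import Data.Nat using (zero; _^_; _<_; _!; z<s; s<s; NonZero; +-0-rawMonoid)
open import Data.Nat.Properties
  using ( +-comm; +-suc; *-assoc; *-identityˡ; *-identityʳ; ^-zeroˡ; ^-distribˡ-+-*; n∸n≡0
        ; <⇒≤; <⇒≱; <-trans; n<1+n; ∸-monoʳ-<; _!*_!≢0
        ; +-0-monoid; +-*-semiring; +-*-commutativeSemiring)
open import Data.Nat.Divisibility using (divides; ∣m⇒∣m*n; m∣m*n; ∣m∣n⇒∣m+n; ∣1⇒≡1; ∣⇒≤; _∣0)
  renaming (_∣_ to _∣ₙ_)
open import Data.Nat.DivMod using (_/_; m/n*n≡m; m≡m%n+[m/n]*n)
open import Data.Nat.Combinatorics using (_C_; nCk≡n!/k![n-k]!; k![n∸k]!∣n!; nCn≡1)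
open import Data.Nat.Primality using (euclidsLemma; prime⇒nonZero; ¬prime[1]; prime?; prime[2])
open import Data.Nat.LCM using (lcm-least)
open import Data.Nat.Tactic.RingSolver using () renaming (solve-∀ to ℕ-solve-∀)
import Data.Integer as ℤ
import Data.Integer.Properties as ℤ
import Data.Integer.Divisibility.Signed as Signed
open import Data.Integer.Tactic.RingSolver using () renaming (solve-∀ to ℤ-solve-∀)
open import Data.Bool using (Bool; true; false)
open import Data.Bool.Properties using (¬-not) renaming (_≟_ to _≟ᵇ_)
open import Data.Fin using (Fin; zero; suc; toℕ; fromℕ; _↑ˡ_; _↑ʳ_; splitAt)
open import Data.Fin.Properties
  using (all?; any?; ¬∀⟶∃¬; ↑ˡ-injective; splitAt-↑ˡ; splitAt-↑ʳ; toℕ-inject₁; toℕ-fromℕ; toℕ<n)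
  renaming (_≟_ to _≟ᶠ_)
open import Data.Fin.Induction using (po-wellFounded)
open import Data.List using (List; []; _∷_; length; filter; map; _++_; cartesianProductWith; allFin)
open import Data.List.Properties using (filter-≐; filter-++; filter-none; length-++)
open import Data.List.Relation.Unary.All as All using (All; []; _∷_)
open import Data.List.Relation.Unary.All.Properties using (tabulate⁺; tabulate⁻)
open import Data.Product using (_,_; proj₁; proj₂; uncurry; ∃-syntax)
open import Data.Sum using (inj₁; inj₂)
open import Data.Vec.Functional using (Vector; tail; init)
open import Function using (_∘_)
open import Induction.WellFounded using (Acc; acc)
open import Level using (0ℓ)
open import Relation.Nullary using (¬_; yes; no; does; contradiction)
open import Relation.Nullary.Decidable using (_×-dec_; _→-dec_; ¬?; dec-true; from-yes)
open import Relation.Unary using (Pred; Decidable; _≐_; _≐′_; _⊆′_; _⟨×⟩_)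
open import Relation.Unary.Properties using (_∩?_; ∁?; ≐′⇒≐)
open import Relation.Binary.Bundles using (Setoid)
import Relation.Binary.Structures as Structures
import Relation.Binary.Construct.NonStrictToStrict as ToStrict
open import Relation.Binary.PropositionalEquality
  using (_≢_; refl; sym; trans; cong; cong₂; subst; isEquivalence; module ≡-Reasoning)
open import Algebra.Properties.CommutativeSemiring.Binomial +-*-commutativeSemiring
  using (theorem; binomialExpansion; binomialTerm)
open import Algebra.Properties.Semiring.Exp +-*-semiring using () renaming (_^_ to _^ₛ_)
open import Algebra.Definitions.RawMonoid +-0-rawMonoid using () renaming (_×_ to _×ₛ_)
open import Algebra.Properties.Monoid.Sum +-0-monoid using (sum; sum-init-last; sum-cong-≗)

-- An order counted by e(m,P) is determined by its blocks: nothing lies below M, M is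
-- an antichain, the elements of K above a given element of M form an up-set of P, and
-- every element of K lies above some element of M, because every element of a finite
-- poset lies above a minimal one; conversely, all such block data are counted.
-- Sorting the block data by the set S ⊆ K of elements lying above no element of M,
-- inclusion-exclusion gives e(m,P) = Σ_S (-1)^|S| u(S)^m, where u(S) is the number
-- of up-sets of P disjoint from S.  For m = n(p-1)+1 Fermat's little theorem gives
-- u^m ≡ u (mod p), hence e(m,P) ≡ e(1,P) = 1 (mod p).  The signs are avoided by
-- running the inclusion-exclusion recurrence directly on congruences.

-- Congruences of natural numbers

infix 4 _≡_mod_

-- A record rather than a definition, so that a and b remain inferable.
record _≡_mod_ (a b p : ℕ) : Set where
  constructor congruent
  field divides-difference : Signed._∣_ (+ p) (+ a - + b)

open _≡_mod_ using (divides-difference)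

module _ {p : ℕ} where

  ≡mod-refl : ∀ {a} → a ≡ a mod p
  ≡mod-refl {a} =
    congruent (Signed.divides (+ 0) (trans (ℤ.+-inverseʳ (+ a)) (sym (ℤ.*-zeroˡ (+ p)))))

  ≡mod-reflexive : ∀ {a b} → a ≡ b → a ≡ b mod p
  ≡mod-reflexive refl = ≡mod-refl

  ≡mod-sym : ∀ {a b} → a ≡ b mod p → b ≡ a mod p
  ≡mod-sym {a} {b} (congruent p∣a-b) =
    congruent (subst (Signed._∣_ (+ p)) (negate (+ a) (+ b)) (Signed.∣m⇒∣-m p∣a-b))
    where
    negate : ∀ a b → ℤ.- (a - b) ≡ b - a
    negate = ℤ-solve-∀

  ≡mod-trans : ∀ {a b c} → a ≡ b mod p → b ≡ c mod p → a ≡ c mod p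
  ≡mod-trans {a} {b} {c} (congruent p∣a-b) (congruent p∣b-c) =
    congruent (subst (Signed._∣_ (+ p)) (telescope (+ a) (+ b) (+ c))
                     (Signed.∣m∣n⇒∣m+n p∣a-b p∣b-c))
    where
    telescope : ∀ a b c → (a - b) ℤ.+ (b - c) ≡ a - c
    telescope = ℤ-solve-∀

  ≡mod-setoid : Setoid 0ℓ 0ℓ
  ≡mod-setoid = record
    { Carrier       = ℕ
    ; _≈_           = λ a b → a ≡ b mod p
    ; isEquivalence = record { refl = ≡mod-refl ; sym = ≡mod-sym ; trans = ≡mod-trans }
    }

  +-congˡ-≡mod : ∀ a {b c} → b ≡ c mod p → a + b ≡ a + c mod p
  +-congˡ-≡mod a {b} {c} (congruent p∣b-c) = congruent (subst (Signed._∣_ (+ p)) eq p∣b-c)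
    where
    eq : + b - + c ≡ + (a + b) - + (a + c)
    eq rewrite ℤ.pos-+ a b | ℤ.pos-+ a c = shift (+ a) (+ b) (+ c)
      where
      shift : ∀ a b c → b - c ≡ (a ℤ.+ b) - (a ℤ.+ c)
      shift = ℤ-solve-∀

  *-congˡ-≡mod : ∀ a {b c} → b ≡ c mod p → a * b ≡ a * c mod p
  *-congˡ-≡mod a {b} {c} (congruent p∣b-c) =
    congruent (subst (Signed._∣_ (+ p)) eq (Signed.∣n⇒∣m*n (+ a) p∣b-c))
    where
    eq : + a ℤ.* (+ b - + c) ≡ + (a * b) - + (a * c)
    eq rewrite ℤ.pos-* a b | ℤ.pos-* a c = distrib (+ a) (+ b) (+ c)
      where
      distrib : ∀ a b c → a ℤ.* (b - c) ≡ a ℤ.* b - a ℤ.* c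
      distrib = ℤ-solve-∀

  +-cancelʳ-≡mod : ∀ {a b c d} → a + b ≡ c + d mod p → b ≡ d mod p → a ≡ c mod p
  +-cancelʳ-≡mod {a} {b} {c} {d} (congruent p∣a+b-c-d) (congruent p∣b-d) =
    congruent (subst (Signed._∣_ (+ p)) eq (Signed.∣m∣n⇒∣m-n p∣a+b-c-d p∣b-d))
    where
    eq : + (a + b) - + (c + d) - (+ b - + d) ≡ + a - + c
    eq rewrite ℤ.pos-+ a b | ℤ.pos-+ c d = cancel (+ a) (+ b) (+ c) (+ d)
      where
      cancel : ∀ a b c d → (a ℤ.+ b) - (c ℤ.+ d) - (b - d) ≡ a - c
      cancel = ℤ-solve-∀

  ∣⇒+≡mod : ∀ {d} a → p ∣ₙ d → d + a ≡ a mod p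
  ∣⇒+≡mod {d} a p∣d = congruent (subst (Signed._∣_ (+ p)) eq (Signed.∣ᵤ⇒∣ p∣d))
    where
    eq : + d ≡ + (d + a) - + a
    eq rewrite ℤ.pos-+ d a = add-sub (+ d) (+ a)
      where
      add-sub : ∀ d a → d ≡ (d ℤ.+ a) - a
      add-sub = ℤ-solve-∀

module ≡mod-Reasoning (p : ℕ) where
  open import Relation.Binary.Reasoning.Setoid (≡mod-setoid {p}) public

-- Fermat's little theorem

^ₛ≡^ : ∀ x n → x ^ₛ n ≡ x ^ n
^ₛ≡^ x zero    = refl
^ₛ≡^ x (suc n) = cong (x *_) (^ₛ≡^ x n)

×ₛ≡* : ∀ c x → c ×ₛ x ≡ c * x
×ₛ≡* zero    x = refl
×ₛ≡* (suc c) x = cong (_+_ x) (×ₛ≡* c x)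

[1+x]^n≡sum : ∀ x n → (1 + x) ^ n ≡ sum {suc n} λ k → (n C toℕ k) * x ^ (n ∸ toℕ k)
[1+x]^n≡sum x n = begin
  (1 + x) ^ n             ≡⟨ ^ₛ≡^ (1 + x) n ⟨
  (1 + x) ^ₛ n            ≡⟨ theorem n 1 x ⟩
  binomialExpansion 1 x n ≡⟨ sum-cong-≗ {suc n} term ⟩
  sum {suc n} (λ k → (n C toℕ k) * x ^ (n ∸ toℕ k)) ∎
  where
  open ≡-Reasoning
  term : ∀ k → binomialTerm 1 x n k ≡ (n C toℕ k) * x ^ (n ∸ toℕ k)
  term k = begin
    (n C toℕ k) ×ₛ (1 ^ₛ toℕ k * x ^ₛ (n ∸ toℕ k)) ≡⟨ ×ₛ≡* (n C toℕ k) _ ⟩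
    (n C toℕ k) * (1 ^ₛ toℕ k * x ^ₛ (n ∸ toℕ k))
      ≡⟨ cong₂ (λ a b → (n C toℕ k) * (a * b))
               (trans (^ₛ≡^ 1 (toℕ k)) (^-zeroˡ (toℕ k))) (^ₛ≡^ x (n ∸ toℕ k)) ⟩
    (n C toℕ k) * (1 * x ^ (n ∸ toℕ k)) ≡⟨ cong ((n C toℕ k) *_) (*-identityˡ _) ⟩
    (n C toℕ k) * x ^ (n ∸ toℕ k)       ∎

nCk*k!*[n∸k]!≡n! : ∀ {n k} → k ≤ n → (n C k) * (k ! * (n ∸ k) !) ≡ n !
nCk*k!*[n∸k]!≡n! {n} {k} k≤n =
  trans (cong (_* (k ! * (n ∸ k) !)) (nCk≡n!/k![n-k]! k≤n))
        (m/n*n≡m {{k !* (n ∸ k) !≢0}} (k![n∸k]!∣n! k≤n))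

n∣n! : ∀ n .{{_ : NonZero n}} → n ∣ₙ n !
n∣n! (suc n) = m∣m*n (n !)

prime∤m! : ∀ {p m} → Prime p → m < p → ¬ p ∣ₙ m !
prime∤m! {m = zero} p-prime _ p∣1 = ¬prime[1] (subst Prime (∣1⇒≡1 p∣1) p-prime)
prime∤m! {m = suc m} p-prime 1+m<p p∣[1+m]! with euclidsLemma (suc m) (m !) p-prime p∣[1+m]!
... | inj₁ p∣1+m = <⇒≱ 1+m<p (∣⇒≤ p∣1+m)
... | inj₂ p∣m!  = prime∤m! p-prime (<-trans (n<1+n m) 1+m<p) p∣m!

prime∣pCk : ∀ {p k} → Prime p → 0 < k → k < p → p ∣ₙ p C k
prime∣pCk {p} {k} p-prime 0<k k<p
  with euclidsLemma (p C k) (k ! * (p ∸ k) !) p-prime p∣C*k!*[p∸k]!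
  where
  p∣C*k!*[p∸k]! : p ∣ₙ (p C k) * (k ! * (p ∸ k) !)
  p∣C*k!*[p∸k]! =
    subst (p ∣ₙ_) (sym (nCk*k!*[n∸k]!≡n! (<⇒≤ k<p))) (n∣n! p {{prime⇒nonZero p-prime}})
... | inj₁ p∣C = p∣C
... | inj₂ p∣k!*[p∸k]! with euclidsLemma (k !) ((p ∸ k) !) p-prime p∣k!*[p∸k]!
...   | inj₁ p∣k!     = contradiction p∣k! (prime∤m! p-prime k<p)
...   | inj₂ p∣[p∸k]! = contradiction p∣[p∸k]! (prime∤m! p-prime (∸-monoʳ-< 0<k (<⇒≤ k<p)))

∣-sum : ∀ {d n} (t : Vector ℕ n) → (∀ i → d ∣ₙ t i) → d ∣ₙ sum t
∣-sum {d} {zero}  t _   = d ∣0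
∣-sum {n = suc n} t d∣t = ∣m∣n⇒∣m+n (d∣t zero) (∣-sum (tail t) (d∣t ∘ suc))

[1+x]^p≡1+x^p : ∀ {p} → Prime p → ∀ x → (1 + x) ^ p ≡ 1 + x ^ p mod p
[1+x]^p≡1+x^p {zero} () x
[1+x]^p≡1+x^p {suc q} p-prime x =
  ≡mod-trans (≡mod-reflexive expand) (∣⇒+≡mod (1 + x ^ suc q) p∣inner)
  where
  term : Vector ℕ (suc q)
  term k = (suc q C suc (toℕ k)) * x ^ (q ∸ toℕ k)
  inner : ℕ
  inner = sum (init term)
  p∣inner : suc q ∣ₙ inner
  p∣inner = ∣-sum (init term) λ k →
    ∣m⇒∣m*n _ (prime∣pCk p-prime z<s (s<s (subst (_< q) (sym (toℕ-inject₁ k)) (toℕ<n k))))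
  last-term : term (fromℕ q) ≡ 1
  last-term = begin
    term (fromℕ q)                ≡⟨ cong (λ k → (suc q C suc k) * x ^ (q ∸ k)) (toℕ-fromℕ q) ⟩
    (suc q C suc q) * x ^ (q ∸ q) ≡⟨ cong₂ (λ c e → c * x ^ e) (nCn≡1 (suc q)) (n∸n≡0 q) ⟩
    1                             ∎
    where open ≡-Reasoning
  expand : (1 + x) ^ suc q ≡ inner + (1 + x ^ suc q)
  expand = begin
    (1 + x) ^ suc q                      ≡⟨ [1+x]^n≡sum x (suc q) ⟩
    1 * x ^ suc q + sum term             ≡⟨ cong₂ _+_ (*-identityˡ (x ^ suc q)) (sum-init-last term) ⟩
    x ^ suc q + (inner + term (fromℕ q)) ≡⟨ cong (λ t → x ^ suc q + (inner + t)) last-term ⟩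
    x ^ suc q + (inner + 1)              ≡⟨ rearrange (x ^ suc q) inner ⟩
    inner + (1 + x ^ suc q)              ∎
    where
    open ≡-Reasoning
    rearrange : ∀ a b → a + (b + 1) ≡ b + (1 + a)
    rearrange = ℕ-solve-∀

x^p≡x : ∀ {p} → Prime p → ∀ x → x ^ p ≡ x mod p
x^p≡x {zero}  ()      _
x^p≡x {suc q} p-prime zero    = ≡mod-refl
x^p≡x {suc q} p-prime (suc x) =
  ≡mod-trans ([1+x]^p≡1+x^p p-prime x) (+-congˡ-≡mod 1 (x^p≡x p-prime x))

x^[n[p∸1]+1]≡x : ∀ {p} → Prime p → ∀ n x → x ^ (n * (p ∸ 1) + 1) ≡ x mod p
x^[n[p∸1]+1]≡x {zero}  ()      _ _
x^[n[p∸1]+1]≡x {suc q} p-prime zero x = begin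
  x ^ 1 ≡⟨ *-identityʳ x ⟩
  x     ∎
  where open ≡mod-Reasoning (suc q)
x^[n[p∸1]+1]≡x {suc q} p-prime (suc n) x = begin
  x ^ (suc n * q + 1)    ≡⟨ cong (x ^_) (exponent n q) ⟩
  x ^ (n * q + suc q)    ≡⟨ ^-distribˡ-+-* x (n * q) (suc q) ⟩
  x ^ (n * q) * x ^ suc q ≈⟨ *-congˡ-≡mod (x ^ (n * q)) (x^p≡x p-prime x) ⟩
  x ^ (n * q) * x        ≡⟨ cong (x ^ (n * q) *_) (*-identityʳ x) ⟨
  x ^ (n * q) * x ^ 1    ≡⟨ ^-distribˡ-+-* x (n * q) 1 ⟨
  x ^ (n * q + 1)        ≈⟨ x^[n[p∸1]+1]≡x p-prime n x ⟩
  x                      ∎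
  where
  open ≡mod-Reasoning (suc q)
  exponent : ∀ n q → suc n * q + 1 ≡ n * q + suc q
  exponent = ℕ-solve-∀

-- Counting the elements of a list that satisfy a predicate

count : {A : Set} {P : Pred A 0ℓ} → Decidable P → List A → ℕ
count P? xs = length (filter P? xs)

module _ {A : Set} {P : Pred A 0ℓ} (P? : Decidable P) where

  count-++ : ∀ xs ys → count P? (xs ++ ys) ≡ count P? xs + count P? ys
  count-++ xs ys = trans (cong length (filter-++ P? xs ys)) (length-++ (filter P? xs))

  count-map : {B : Set} (f : B → A) (xs : List B) → count P? (map f xs) ≡ count (P? ∘ f) xs
  count-map f []       = refl
  count-map f (x ∷ xs) with P? (f x)
  ... | yes _ = cong suc (count-map f xs)
  ... | no _  = count-map f xs

  count-≐′ : {Q : Pred A 0ℓ} (Q? : Decidable Q) → P ≐′ Q → ∀ xs → count P? xs ≡ count Q? xs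
  count-≐′ Q? P≐Q xs = cong length (filter-≐ P? Q? (≐′⇒≐ P≐Q) xs)

  count-∩-∁ : {Q : Pred A 0ℓ} (Q? : Decidable Q) →
              ∀ xs → count P? xs ≡ count (P? ∩? Q?) xs + count (P? ∩? ∁? Q?) xs
  count-∩-∁ Q? []       = refl
  count-∩-∁ Q? (x ∷ xs) with P? x | Q? x
  ... | yes _ | yes _ = cong suc (count-∩-∁ Q? xs)
  ... | yes _ | no _  = trans (cong suc (count-∩-∁ Q? xs)) (sym (+-suc _ _))
  ... | no _  | _     = count-∩-∁ Q? xs

count-cartesianProductWith :
  {X Y Z : Set} {P : Pred Z 0ℓ} {Q : Pred X 0ℓ} {R : Pred Y 0ℓ}
  (P? : Decidable P) (Q? : Decidable Q) (R? : Decidable R) (f : X → Y → Z) →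
  P ∘ uncurry f ≐ (Q ⟨×⟩ R) →
  ∀ xs ys → count P? (cartesianProductWith f xs ys) ≡ count Q? xs * count R? ys
count-cartesianProductWith P? Q? R? f P≐Q×R []       ys = refl
count-cartesianProductWith P? Q? R? f P≐Q×R (x ∷ xs) ys with Q? x
... | yes qx = trans (count-++ P? (map (f x) ys) _) (cong₂ _+_ row rest)
  where
  row : count P? (map (f x) ys) ≡ count R? ys
  row = trans (count-map P? (f x) ys)
    (count-≐′ (P? ∘ f x) R? ((λ _ → proj₂ ∘ proj₁ P≐Q×R) , λ _ r → proj₂ P≐Q×R (qx , r))
              ys)
  rest : count P? (cartesianProductWith f xs ys) ≡ count Q? xs * count R? ys
  rest = count-cartesianProductWith P? Q? R? f P≐Q×R xs ys
... | no ¬qx = trans (count-++ P? (map (f x) ys) _) (cong₂ _+_ row rest)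
  where
  row : count P? (map (f x) ys) ≡ 0
  row = trans (count-map P? (f x) ys)
    (cong length (filter-none (P? ∘ f x) (All.universal (λ _ → ¬qx ∘ proj₁ ∘ proj₁ P≐Q×R) ys)))
  rest : count P? (cartesianProductWith f xs ys) ≡ count Q? xs * count R? ys
  rest = count-cartesianProductWith P? Q? R? f P≐Q×R xs ys

module _ {A : Set} (xs : List A) where

  count-allFuns-∀ : ∀ n {Q : Fin n → Pred A 0ℓ} (Q? : ∀ i → Decidable (Q i)) {c} →
    (∀ i → count (Q? i) xs ≡ c) →
    count (λ f → all? λ i → Q? i (f i)) (allFuns xs n) ≡ c ^ n
  count-allFuns-∀ zero Q? _ = refl
  count-allFuns-∀ (suc n) Q? {c} count≡c = begin
    count (λ f → all? λ i → Q? i (f i)) (cartesianProductWith cons xs (allFuns xs n))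
      ≡⟨ count-cartesianProductWith _ (Q? zero) (λ f → all? λ i → Q? (suc i) (f i)) cons
           ((λ h → h zero , h ∘ suc) , λ { (q , h) → λ { zero → q ; (suc i) → h i } }) xs _ ⟩
    count (Q? zero) xs * count (λ f → all? λ i → Q? (suc i) (f i)) (allFuns xs n)
      ≡⟨ cong₂ _*_ (count≡c zero) (count-allFuns-∀ n (Q? ∘ suc) (count≡c ∘ suc)) ⟩
    c * c ^ n ∎
    where open ≡-Reasoning

  count-allFuns-split : ∀ m k {Q : Fin m → Pred A 0ℓ} (Q? : ∀ i → Decidable (Q i)) {c} →
    (∀ i → count (Q? i) xs ≡ c) →
    {B : Pred (Fin k → A) 0ℓ} (B? : Decidable B) →
    count (λ f → all? (λ i → Q? i (f (i ↑ˡ k))) ×-dec B? (λ j → f (m ↑ʳ j))) (allFuns xs (m + k))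
      ≡ c ^ m * count B? (allFuns xs k)
  count-allFuns-split zero k Q? _ B? =
    trans (count-≐′ _ B? ((λ _ → proj₂) , λ _ b → (λ ()) , b) (allFuns xs k)) (sym (*-identityˡ _))
  count-allFuns-split (suc m) k {Q} Q? {c} count≡c {B} B? = begin
    count (λ f → all? (λ i → Q? i (f (i ↑ˡ k))) ×-dec B? (λ j → f (suc m ↑ʳ j)))
          (cartesianProductWith cons xs (allFuns xs (m + k)))
      ≡⟨ count-cartesianProductWith _ (Q? zero) tail? cons
           ( (λ { (h , b) → h zero , (h ∘ suc , b) })
           , λ { (q , (h , b)) → (λ { zero → q ; (suc i) → h i }) , b }) xs _ ⟩
    count (Q? zero) xs * count tail? (allFuns xs (m + k))
      ≡⟨ cong₂ _*_ (count≡c zero) (count-allFuns-split m k (Q? ∘ suc) (count≡c ∘ suc) B?) ⟩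
    c * (c ^ m * count B? (allFuns xs k))
      ≡⟨ *-assoc c _ _ ⟨
    c ^ suc m * count B? (allFuns xs k) ∎
    where
    open ≡-Reasoning
    tail? : Decidable λ f → (∀ i → Q (suc i) (f (i ↑ˡ k))) × B (λ j → f (m ↑ʳ j))
    tail? f = all? (λ i → Q? (suc i) (f (i ↑ˡ k))) ×-dec B? (λ j → f (m ↑ʳ j))

bools : List Bool
bools = true ∷ false ∷ []

count-bools-≟ : ∀ b → count (_≟ᵇ b) bools ≡ 1
count-bools-≟ true  = refl
count-bools-≟ false = refl

count-allBRel-≗ : ∀ {N} (R₀ : BRel N) →
  count (λ R → all? λ x → all? λ y → R x y ≟ᵇ R₀ x y) (allBRel N) ≡ 1
count-allBRel-≗ {N} R₀ = trans
  (count-allFuns-∀ (allFuns bools N) N (λ x r → all? λ y → r y ≟ᵇ R₀ x y) λ x →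
     trans (count-allFuns-∀ bools N (λ y b → b ≟ᵇ R₀ x y) (λ y → count-bools-≟ (R₀ x y))) (^-zeroˡ N))
  (^-zeroˡ N)

-- Minimal elements of finite posets

module _ {N : ℕ} {R : BRel N} where

  toIsPartialOrder : IsPartialOrder R → Structures.IsPartialOrder _≡_ (λ x y → R x y ≡ true)
  toIsPartialOrder (reflexive , antisymmetric , transitive) = record
    { isPreorder = record
      { isEquivalence = isEquivalence
      ; reflexive     = λ { refl → reflexive _ }
      ; trans         = transitive _ _ _
      }
    ; antisym = antisymmetric _ _
    }

  ¬minimal⇒strictlyBelow : ∀ {x} → ¬ Minimal R x → ∃[ y ] R y x ≡ true × y ≢ x
  ¬minimal⇒strictlyBelow {x} ¬min
    with y , ¬[Ryx⇒y≡x] ← ¬∀⟶∃¬ N _ (λ y → (R y x ≟ᵇ true) →-dec (y ≟ᶠ x)) ¬min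
    with R y x ≟ᵇ true
  ... | yes Ryx = y , Ryx , λ y≡x → ¬[Ryx⇒y≡x] (λ _ → y≡x)
  ... | no ¬Ryx = contradiction (λ Ryx → contradiction Ryx ¬Ryx) ¬[Ryx⇒y≡x]

  minimal-below : IsPartialOrder R → ∀ x → ∃[ y ] Minimal R y × R y x ≡ true
  minimal-below po@(reflexive , _ , transitive) x = go x (po-wellFounded (toIsPartialOrder po) x)
    where
    go : ∀ x → Acc (ToStrict._<_ _≡_ (λ x y → R x y ≡ true)) x → ∃[ y ] Minimal R y × R y x ≡ true
    go x (acc below) with minimal? R x
    ... | yes min = x , min , reflexive x
    ... | no ¬min
      with y , Ryx , y≢x ← ¬minimal⇒strictlyBelow ¬min
      with z , min , Rzy ← go y (below (Ryx , y≢x))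
      = z , min , transitive z y x Rzy Ryx

-- Orders with prescribed minimal elements

data Side (m k : ℕ) : Fin (m + k) → Set where
  left  : (i : Fin m) → Side m k (i ↑ˡ k)
  right : (j : Fin k) → Side m k (m ↑ʳ j)

side : ∀ m {k} (x : Fin (m + k)) → Side m k x
side zero    x       = right x
side (suc m) zero    = left zero
side (suc m) (suc x) with side m x
... | left i  = left (suc i)
... | right j = right j

↑ˡ≢↑ʳ : ∀ {m k} (i : Fin m) (j : Fin k) → i ↑ˡ k ≢ m ↑ʳ j
↑ˡ≢↑ʳ {m} {k} i j eq
  with () ← trans (sym (splitAt-↑ˡ m i k)) (trans (cong (splitAt m) eq) (splitAt-↑ʳ m k j))

does-≟⇒≡ : ∀ {n} {i j : Fin n} → does (i ≟ᶠ j) ≡ true → i ≡ j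
does-≟⇒≡ {i = i} {j} eq with i ≟ᶠ j
... | yes i≡j = i≡j

module _ {k : ℕ} (P : BRel k) where

  IsUpSet : Pred (Fin k → Bool) 0ℓ
  IsUpSet s = ∀ j j' → P j j' ≡ true → s j ≡ true → s j' ≡ true

  UpSetAvoiding : List (Fin k) → Pred (Fin k → Bool) 0ℓ
  UpSetAvoiding fs s = IsUpSet s × All (λ j → s j ≡ false) fs

  upSetAvoiding? : ∀ fs → Decidable (UpSetAvoiding fs)
  upSetAvoiding? fs s =
    (all? λ j → all? λ j' → (P j j' ≟ᵇ true) →-dec ((s j ≟ᵇ true) →-dec (s j' ≟ᵇ true)))
    ×-dec All.all? (λ j → s j ≟ᵇ false) fs

  upSetsAvoiding : List (Fin k) → ℕ
  upSetsAvoiding fs = count (upSetAvoiding? fs) (allFuns bools k)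

  -- Row x of a relation R on M ∪ K is R x, the set of elements above x.
  module Blocks (m : ℕ) where

    MRow : List (Fin k) → Fin m → Pred (Fin (m + k) → Bool) 0ℓ
    MRow fs i r = (∀ i' → r (i' ↑ˡ k) ≡ does (i ≟ᶠ i')) × UpSetAvoiding fs (λ j → r (m ↑ʳ j))

    mRow? : ∀ fs i → Decidable (MRow fs i)
    mRow? fs i r =
      all? (λ i' → r (i' ↑ˡ k) ≟ᵇ does (i ≟ᶠ i')) ×-dec upSetAvoiding? fs (λ j → r (m ↑ʳ j))

    KRow : Fin k → Pred (Fin (m + k) → Bool) 0ℓ
    KRow j r = (∀ i → r (i ↑ˡ k) ≡ false) × (∀ j' → r (m ↑ʳ j') ≡ P j j')

    kRow? : ∀ j → Decidable (KRow j)
    kRow? j r = all? (λ i → r (i ↑ˡ k) ≟ᵇ false) ×-dec all? (λ j' → r (m ↑ʳ j') ≟ᵇ P j j')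

    BlockForm : List (Fin k) → Pred (BRel (m + k)) 0ℓ
    BlockForm fs R = (∀ i → MRow fs i (R (i ↑ˡ k))) × (∀ j → KRow j (R (m ↑ʳ j)))

    blockForm? : ∀ fs → Decidable (BlockForm fs)
    blockForm? fs R = all? (λ i → mRow? fs i (R (i ↑ˡ k))) ×-dec all? (λ j → kRow? j (R (m ↑ʳ j)))

    Covered : BRel (m + k) → Pred (Fin k) 0ℓ
    Covered R j = ∃[ i ] R (i ↑ˡ k) (m ↑ʳ j) ≡ true

    covered? : ∀ R → Decidable (Covered R)
    covered? R j = any? λ i → R (i ↑ˡ k) (m ↑ʳ j) ≟ᵇ true

    counted⇒blockForm : ∀ {R} → Counted m P R → BlockForm [] R × (∀ j → Covered R j)
    counted⇒blockForm {R} (po@(reflexive , _ , transitive) , restricts , minimalM , ¬minimalK) =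
      ((λ i → diagonal i , (upward i , [])) , (λ j → k→m j , restricts j)) , covered
      where
      diagonal : ∀ i i' → R (i ↑ˡ k) (i' ↑ˡ k) ≡ does (i ≟ᶠ i')
      diagonal i i' with i ≟ᶠ i'
      ... | yes refl = reflexive (i ↑ˡ k)
      ... | no i≢i'  = ¬-not λ Rii' → i≢i' (↑ˡ-injective k i i' (minimalM i' (i ↑ˡ k) Rii'))
      upward : ∀ i → IsUpSet (λ j → R (i ↑ˡ k) (m ↑ʳ j))
      upward i j j' Pjj' Rij = transitive _ _ _ Rij (trans (restricts j j') Pjj')
      k→m : ∀ j i → R (m ↑ʳ j) (i ↑ˡ k) ≡ false
      k→m j i = ¬-not λ Rji → ↑ˡ≢↑ʳ i j (sym (minimalM i (m ↑ʳ j) Rji))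
      covered : ∀ j → Covered R j
      covered j with minimal-below po (m ↑ʳ j)
      ... | y , min , Ryj with side m y
      ...   | left i   = i , Ryj
      ...   | right j' = contradiction min (¬minimalK j')

    blockForm⇒counted : IsPartialOrder P →
                        ∀ {R} → BlockForm [] R → (∀ j → Covered R j) → Counted m P R
    blockForm⇒counted (reflexiveP , antisymmetricP , transitiveP) {R} (mRows , kRows) covered =
      (reflexive , antisymmetric , transitive) , blockKK , minimalM , ¬minimalK
      where
      blockMM : ∀ i i' → R (i ↑ˡ k) (i' ↑ˡ k) ≡ does (i ≟ᶠ i')
      blockMM i = proj₁ (mRows i)
      upward : ∀ i → IsUpSet (λ j → R (i ↑ˡ k) (m ↑ʳ j))
      upward i = proj₁ (proj₂ (mRows i))
      blockKK : ∀ j j' → R (m ↑ʳ j) (m ↑ʳ j') ≡ P j j'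
      blockKK j = proj₂ (kRows j)
      ¬blockKM : ∀ {A : Set} j i → R (m ↑ʳ j) (i ↑ˡ k) ≡ true → A
      ¬blockKM j i Rji with () ← trans (sym Rji) (proj₁ (kRows j) i)
      blockMM⇒≡ : ∀ {i i'} → R (i ↑ˡ k) (i' ↑ˡ k) ≡ true → i ≡ i'
      blockMM⇒≡ {i} {i'} Rii' = does-≟⇒≡ (trans (sym (blockMM i i')) Rii')
      blockKK⇒P : ∀ {j j'} → R (m ↑ʳ j) (m ↑ʳ j') ≡ true → P j j' ≡ true
      blockKK⇒P {j} {j'} = trans (sym (blockKK j j'))

      reflexive : ∀ x → R x x ≡ true
      reflexive x with side m x
      ... | left i  = trans (blockMM i i) (dec-true (i ≟ᶠ i) refl)
      ... | right j = trans (blockKK j j) (reflexiveP j)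

      antisymmetric : ∀ x y → R x y ≡ true → R y x ≡ true → x ≡ y
      antisymmetric x y Rxy Ryx with side m x | side m y
      ... | left i  | left i'  = cong (_↑ˡ k) (blockMM⇒≡ Rxy)
      ... | left i  | right j  = ¬blockKM j i Ryx
      ... | right j | left i   = ¬blockKM j i Rxy
      ... | right j | right j' = cong (m ↑ʳ_) (antisymmetricP j j' (blockKK⇒P Rxy) (blockKK⇒P Ryx))

      transitive : ∀ x y z → R x y ≡ true → R y z ≡ true → R x z ≡ true
      transitive x y z Rxy Ryz with side m x | side m y | side m z
      ... | left i  | left i'  | _ rewrite blockMM⇒≡ Rxy = Ryz
      ... | left i  | right j  | left i'  = ¬blockKM j i' Ryz
      ... | left i  | right j  | right j' = upward i j j' (blockKK⇒P Ryz) Rxy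
      ... | right j | left i   | _        = ¬blockKM j i Rxy
      ... | right j | right j' | left i   = ¬blockKM j' i Ryz
      ... | right j | right j' | right j'' =
        trans (blockKK j j'') (transitiveP j j' j'' (blockKK⇒P Rxy) (blockKK⇒P Ryz))

      minimalM : ∀ i → Minimal R (i ↑ˡ k)
      minimalM i y Ryi with side m y
      ... | left i' = cong (_↑ˡ k) (blockMM⇒≡ Ryi)
      ... | right j = ¬blockKM j i Ryi

      ¬minimalK : ∀ j → ¬ Minimal R (m ↑ʳ j)
      ¬minimalK j min with i , Rij ← covered j = ↑ˡ≢↑ʳ i j (min (i ↑ˡ k) Rij)

    Constrained : List (Fin k) → List (Fin k) → Pred (BRel (m + k)) 0ℓ
    Constrained fs js R = BlockForm [] R × All (Covered R) js × All (¬_ ∘ Covered R) fs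

    constrained? : ∀ fs js → Decidable (Constrained fs js)
    constrained? fs js R =
      blockForm? [] R ×-dec All.all? (covered? R) js ×-dec All.all? (¬? ∘ covered? R) fs

    coverCount : List (Fin k) → List (Fin k) → ℕ
    coverCount fs js = count (constrained? fs js) (allBRel (m + k))

    coverCount-step : ∀ fs j js →
                      coverCount fs (j ∷ js) + coverCount (j ∷ fs) js ≡ coverCount fs js
    coverCount-step fs j js = sym (trans
      (count-∩-∁ (constrained? fs js) (λ R → covered? R j) (allBRel (m + k)))
      (cong₂ _+_
        (count-≐′ _ (constrained? fs (j ∷ js))
          ( (λ { _ ((b , c , u) , cj) → b , cj ∷ c , u })
          , (λ { _ (b , cj ∷ c , u) → (b , c , u) , cj }))
          (allBRel (m + k)))
        (count-≐′ _ (constrained? (j ∷ fs) js)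
          ( (λ { _ ((b , c , u) , ¬cj) → b , c , ¬cj ∷ u })
          , (λ { _ (b , c , ¬cj ∷ u) → (b , c , u) , ¬cj }))
          (allBRel (m + k)))))

    private
      rows : List (Fin (m + k) → Bool)
      rows = allFuns bools (m + k)

      count-mRow : ∀ fs i → count (mRow? fs i) rows ≡ upSetsAvoiding fs
      count-mRow fs i = begin
        count (mRow? fs i) rows
          ≡⟨ count-allFuns-split bools m k (λ i' b → b ≟ᵇ does (i ≟ᶠ i'))
                                 (λ i' → count-bools-≟ (does (i ≟ᶠ i'))) (upSetAvoiding? fs) ⟩
        1 ^ m * upSetsAvoiding fs ≡⟨ cong (_* upSetsAvoiding fs) (^-zeroˡ m) ⟩
        1 * upSetsAvoiding fs     ≡⟨ *-identityˡ _ ⟩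
        upSetsAvoiding fs         ∎
        where open ≡-Reasoning

      count-kRow : ∀ j → count (kRow? j) rows ≡ 1
      count-kRow j = begin
        count (kRow? j) rows
          ≡⟨ count-allFuns-split bools m k (λ _ b → b ≟ᵇ false) (λ _ → refl) _ ⟩
        1 ^ m * count (λ s → all? λ j' → s j' ≟ᵇ P j j') (allFuns bools k)
          ≡⟨ cong₂ _*_ (^-zeroˡ m)
                       (count-allFuns-∀ bools k (λ j' b → b ≟ᵇ P j j') (λ j' → count-bools-≟ (P j j'))) ⟩
        1 * 1 ^ k ≡⟨ cong (1 *_) (^-zeroˡ k) ⟩
        1         ∎
        where open ≡-Reasoning

    count-blockForm : ∀ fs → count (blockForm? fs) (allBRel (m + k)) ≡ upSetsAvoiding fs ^ m
    count-blockForm fs = begin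
      count (blockForm? fs) (allBRel (m + k))
        ≡⟨ count-allFuns-split rows m k (mRow? fs) (count-mRow fs) _ ⟩
      upSetsAvoiding fs ^ m * count (λ G → all? λ j → kRow? j (G j)) (allFuns rows k)
        ≡⟨ cong (upSetsAvoiding fs ^ m *_) (trans (count-allFuns-∀ rows k kRow? count-kRow) (^-zeroˡ k)) ⟩
      upSetsAvoiding fs ^ m * 1
        ≡⟨ *-identityʳ _ ⟩
      upSetsAvoiding fs ^ m ∎
      where open ≡-Reasoning

    coverCount-[] : ∀ fs → coverCount fs [] ≡ upSetsAvoiding fs ^ m
    coverCount-[] fs =
      trans (count-≐′ (constrained? fs []) (blockForm? fs) (to , from) (allBRel (m + k))) (count-blockForm fs)
      where
      to : Constrained fs [] ⊆′ BlockForm fs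
      to R ((mRows , kRows) , [] , uncovered) =
        (λ i → proj₁ (mRows i) , proj₁ (proj₂ (mRows i)) ,
               All.map (λ ¬cov → ¬-not λ Rij → ¬cov (i , Rij)) uncovered) , kRows
      from : BlockForm fs ⊆′ Constrained fs []
      from R (mRows , kRows) =
        ((λ i → proj₁ (mRows i) , proj₁ (proj₂ (mRows i)) , []) , kRows) , [] ,
        All.tabulate λ j∈fs (i , Rij) →
          contradiction (trans (sym Rij) (All.lookup (proj₂ (proj₂ (mRows i))) j∈fs)) λ ()

    e≡coverCount : IsPartialOrder P → e m P ≡ coverCount [] (allFin k)
    e≡coverCount poP =
      count-≐′ (counted? m P) (constrained? [] (allFin k)) (to , from) (allBRel (m + k))
      where
      to : Counted m P ⊆′ Constrained [] (allFin k)
      to _ c with blocks , covered ← counted⇒blockForm c = blocks , tabulate⁺ covered , []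
      from : Constrained [] (allFin k) ⊆′ Counted m P
      from _ (blocks , covered , []) = blockForm⇒counted poP blocks (tabulate⁻ covered)

module _ {k : ℕ} (P : BRel k) where
  open Blocks P 1

  cone : BRel (1 + k)
  cone zero    _       = true
  cone (suc j) zero    = false
  cone (suc j) (suc j') = P j j'

  e[1]≡1 : IsPartialOrder P → e 1 P ≡ 1
  e[1]≡1 poP = trans (count-≐′ (counted? 1 P) _ (to , from) (allBRel (1 + k))) (count-allBRel-≗ cone)
    where
    to : Counted 1 P ⊆′ (λ R → ∀ x y → R x y ≡ cone x y)
    to R c with (mRows , kRows) , covered ← counted⇒blockForm c = entry
      where
      entry : ∀ x y → R x y ≡ cone x y
      entry zero    zero     = proj₁ (mRows zero) zero
      entry zero    (suc j)  with zero , R0j ← covered j = R0j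
      entry (suc j) zero     = proj₁ (kRows j) zero
      entry (suc j) (suc j') = proj₂ (kRows j) j'
    from : (λ R → ∀ x y → R x y ≡ cone x y) ⊆′ Counted 1 P
    from R R≗cone = blockForm⇒counted poP
      ((λ { zero → (λ { zero → R≗cone zero zero }) , (λ _ j' _ _ → R≗cone zero (suc j')) , [] }) ,
       (λ j → (λ { zero → R≗cone (suc j) zero }) , λ j' → R≗cone (suc j) (suc j')))
      (λ j → zero , R≗cone zero (suc j))

-- The congruence e(n(p-1)+1, P) ≡ 1 (mod p)

recurrence-≡mod : {A : Set} {p : ℕ} (f g : List A → List A → ℕ) →
  (∀ fs j js → f fs (j ∷ js) + f (j ∷ fs) js ≡ f fs js) →
  (∀ fs j js → g fs (j ∷ js) + g (j ∷ fs) js ≡ g fs js) →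
  (∀ fs → f fs [] ≡ g fs [] mod p) →
  ∀ js fs → f fs js ≡ g fs js mod p
recurrence-≡mod f g f-step g-step base []       fs = base fs
recurrence-≡mod {p = p} f g f-step g-step base (j ∷ js) fs = +-cancelʳ-≡mod
  (begin
    f fs (j ∷ js) + f (j ∷ fs) js ≡⟨ f-step fs j js ⟩
    f fs js                       ≈⟨ recurrence-≡mod f g f-step g-step base js fs ⟩
    g fs js                       ≡⟨ g-step fs j js ⟨
    g fs (j ∷ js) + g (j ∷ fs) js ∎)
  (recurrence-≡mod f g f-step g-step base js (j ∷ fs))
  where open ≡mod-Reasoning p

%≡1⇒≡n*c+1 : ∀ {m d c} .{{_ : NonZero d}} → m % d ≡ 1 → c ∣ₙ d → ∃[ n ] m ≡ n * c + 1
%≡1⇒≡n*c+1 {m} {d} {c} m%d≡1 (divides q d≡q*c) = m / d * q , (begin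
  m                       ≡⟨ m≡m%n+[m/n]*n m d ⟩
  m % d + m / d * d       ≡⟨ cong (_+ m / d * d) m%d≡1 ⟩
  1 + m / d * d           ≡⟨ cong (λ t → 1 + m / d * t) d≡q*c ⟩
  1 + m / d * (q * c)     ≡⟨ regroup (m / d) q c ⟩
  m / d * q * c + 1       ∎)
  where
  open ≡-Reasoning
  regroup : ∀ a q c → 1 + a * (q * c) ≡ a * q * c + 1
  regroup = ℕ-solve-∀

module _ {k : ℕ} {P : BRel k} (poP : IsPartialOrder P) where
  private module B (m : ℕ) = Blocks P m

  e[n[p∸1]+1]≡1 : ∀ {p} → Prime p → ∀ n → e (n * (p ∸ 1) + 1) P ≡ 1 mod p
  e[n[p∸1]+1]≡1 {p} p-prime n = begin
    e m P                        ≡⟨ B.e≡coverCount m poP ⟩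
    B.coverCount m [] (allFin k)
      ≈⟨ recurrence-≡mod (B.coverCount m) (B.coverCount 1) (B.coverCount-step m) (B.coverCount-step 1)
                         base (allFin k) [] ⟩
    B.coverCount 1 [] (allFin k) ≡⟨ B.e≡coverCount 1 poP ⟨
    e 1 P                        ≡⟨ e[1]≡1 P poP ⟩
    1                            ∎
    where
    open ≡mod-Reasoning p
    m : ℕ
    m = n * (p ∸ 1) + 1
    base : ∀ fs → B.coverCount m fs [] ≡ B.coverCount 1 fs [] mod p
    base fs = begin
      B.coverCount m fs []    ≡⟨ B.coverCount-[] m fs ⟩
      upSetsAvoiding P fs ^ m ≈⟨ x^[n[p∸1]+1]≡x p-prime n _ ⟩
      upSetsAvoiding P fs     ≡⟨ *-identityʳ _ ⟨
      upSetsAvoiding P fs ^ 1 ≡⟨ B.coverCount-[] 1 fs ⟨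
      B.coverCount 1 fs []    ∎

  prime∣e-1 : ∀ {p} m → Prime p → ∃[ n ] m ≡ n * (p ∸ 1) + 1 → + p ∣ + e m P - + 1
  prime∣e-1 _ p-prime (n , refl) = Signed.∣⇒∣ᵤ (divides-difference (e[n[p∸1]+1]≡1 p-prime n))

  2∣e-1 : ∀ m → 1 ≤ m → + 2 ∣ + e m P - + 1
  2∣e-1 (suc m) _ =
    prime∣e-1 (suc m) prime[2] (m , trans (+-comm 1 m) (cong (_+ 1) (sym (*-identityʳ m))))

  %≡1⇒prime∣e-1 : ∀ {p} m {d} .{{_ : NonZero d}} →
                  Prime p → m % d ≡ 1 → (p ∸ 1) ∣ₙ d → + p ∣ + e m P - + 1
  %≡1⇒prime∣e-1 m p-prime m%d≡1 p-1∣d = prime∣e-1 m p-prime (%≡1⇒≡n*c+1 m%d≡1 p-1∣d)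

corollary4p3 : (k : ℕ) (P : BRel k) → IsPartialOrder P →
    ((n p : ℕ) → 1 ≤ n → Prime p →
       (+ p) ∣ (+ e (n * (p ∸ 1) + 1) P - + 1)) ×
    ((m : ℕ) → 1 ≤ m →
       ((+ 2) ∣ (+ e m P - + 1)) ×
       (m % 2 ≡ 1 → (+ 6) ∣ (+ e m P - + 1)) ×
       (m % 4 ≡ 1 → (+ 30) ∣ (+ e m P - + 1)) ×
       (m % 6 ≡ 1 → (+ 42) ∣ (+ e m P - + 1)) ×
       (m % 12 ≡ 1 → (+ 210) ∣ (+ e m P - + 1)))
-- The divisors are
-- combined with lcm-least since + d ∣ x unfolds to d ∣ ∣ x ∣ and lcm 2 3 reduces to 6.
corollary4p3 k P poP =
  (λ n p _ p-prime → prime∣e-1 poP (n * (p ∸ 1) + 1) p-prime (n , refl)) , λ m 1≤m →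
  let 2∣ = 2∣e-1 poP m 1≤m
      p∣ : ∀ {p d} .{{_ : NonZero d}} → Prime p → m % d ≡ 1 → (p ∸ 1) ∣ₙ d → + p ∣ + e m P - + 1
      p∣ = %≡1⇒prime∣e-1 poP m
  in  2∣
    , (λ m≡1[2]  → lcm-least 2∣ (p∣ prime[3] m≡1[2] (divides 1 refl)))
    , (λ m≡1[4]  → lcm-least (lcm-least 2∣ (p∣ prime[3] m≡1[4] (divides 2 refl)))
                             (p∣ prime[5] m≡1[4] (divides 1 refl)))
    , (λ m≡1[6]  → lcm-least (lcm-least 2∣ (p∣ prime[3] m≡1[6] (divides 3 refl)))
                             (p∣ prime[7] m≡1[6] (divides 1 refl)))
    , (λ m≡1[12] → lcm-least (lcm-least (lcm-least 2∣ (p∣ prime[3] m≡1[12] (divides 6 refl)))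
                                        (p∣ prime[5] m≡1[12] (divides 3 refl)))
                             (p∣ prime[7] m≡1[12] (divides 2 refl)))
  where
  prime[3] : Prime 3
  prime[3] = from-yes (prime? 3)
  prime[5] : Prime 5
  prime[5] = from-yes (prime? 5)
  prime[7] : Prime 7
  prime[7] = from-yes (prime? 7)
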